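{- The operators $\widehat{\cup}$ and unary $\widehat{ - }$ on neutrosophic relations are strong generalizations of the operators $\cup$ and unary $-$ on fuzzy relations, respectively.
   Context: A relation scheme is a finite set of attribute names with nonempty domains; $\tau(\Sigma)$ is the set of tuples on $\Sigma$; $\mathcal F(\Sigma)$ is the set of fuzzy relations, maps $\tau(\Sigma)\to[0,1]$. A neutrosophic relation $R$ on $\Sigma$ assigns to each $t$ a pair $\langle R(t)^+,R(t)^-\rangle\in[0,1]^2$; $\mathcal V(\Sigma)$ is the set of these. $R$ is consistent if $R(t)^++R(t)^-\le1$ for all $t$. For consistent $R$, $\mathbf{reps}_\Sigma(R)=\{Q\in\mathcal F(\Sigma): R(t)^+\le Q(t)\le1-R(t)^-\ \forall t\}$. For an operator $\Theta:\mathcal F(\Sigma_1)\times\cdots\times\mathcal F(\Sigma_n)\to\mathcal F(\Sigma_{n+1})$, $\mathcal S(\Theta)(M_1,\dots,M_n)=\{\Theta(R_1,\dots,R_n):R_i\in M_i\}$. An operator $\Psi:\mathcal V(\Sigma_1)\times\cdots\times\mathcal V(\Sigma_n)\to\mathcal V(\Sigma_{n+1})$ is a strong generalization of $\Theta$ if it maps consistent arguments to consistent results and $\mathbf{reps}_{\Sigma_{n+1}}(\Psi(R_1,\dots,R_n))=\mathcal S(\Theta)(\mathbf{reps}_{\Sigma_1}(R_1),\dots,\mathbf{reps}_{\Sigma_n}(R_n))$ for all consistent $R_i$. Fuzzy operators on a scheme $\Sigma$: $(R\cup S)(t)=\max\{R(t),S(t)\}$, $(-R)(t)=1-R(t)$.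 Neutrosophic operators: $(R\,\widehat\cup\,S)(t)=\langle\max\{R(t)^+,S(t)^+\},\min\{R(t)^-,S(t)^-\}\rangle$, $(\widehat- R)(t)=\langle R(t)^-,R(t)^+\rangle$. -}

module Defs where

open import Data.Nat using (ℕ)
open import Data.Fin using (Fin)
open import Data.Product using (Σ; ∃; _×_; _,_; proj₁; proj₂)
open import Data.Sum using (_⊎_; inj₁; inj₂)
open import Relation.Binary.PropositionalEquality using (_≡_; _≢_; subst; sym)
open import Relation.Binary.Structures using (IsTotalOrder)
open import Algebra.Structures using (IsCommutativeRing)
open import Function.Bundles using (_⇔_)

-- The real numbers, axiomatised as a (Dedekind-)complete ordered field.
-- (agda-stdlib has no reals; all such structures are isomorphic, so
-- quantifying over every one of them is the same as speaking about ℝ.)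

record Reals : Set₁ where
  infixl 6 _+_
  infixl 7 _*_
  infix 4 _≤_
  field
    ℝ : Set
    _+_ _*_ : ℝ → ℝ → ℝ
    -_ : ℝ → ℝ
    0r 1r : ℝ
    _≤_ : ℝ → ℝ → Set
    isCommutativeRing : IsCommutativeRing _≡_ _+_ _*_ -_ 0r 1r
    0≢1 : 0r ≢ 1r
    *-inverse : ∀ x → x ≢ 0r → ∃ λ y → x * y ≡ 1r
    isTotalOrder : IsTotalOrder _≡_ _≤_
    +-monoˡ-≤ : ∀ {x y} z → x ≤ y → x + z ≤ y + z
    *-nonneg : ∀ {x y} → 0r ≤ x → 0r ≤ y → 0r ≤ x * y
    complete : (P : ℝ → Set) → ∃ P → (∃ λ b → ∀ x → P x → x ≤ b) →
               ∃ λ s → (∀ x → P x → x ≤ s) × (∀ b → (∀ x → P x → x ≤ b) → s ≤ b)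

record Scheme : Set₁ where
  field
    size     : ℕ
    dom      : Fin size → Set
    nonempty : (a : Fin size) → dom a

τ : Scheme → Set
τ S = (a : Fin (Scheme.size S)) → Scheme.dom S a

module WithReals (ℛ : Reals) where
  open Reals ℛ public
  open IsCommutativeRing isCommutativeRing using (+-comm; +-identityˡ; -‿inverseʳ)
  open IsTotalOrder isTotalOrder using (total; trans)

  I : Set
  I = Σ ℝ (λ x → (0r ≤ x) × (x ≤ 1r))

  val : I → ℝ
  val = proj₁

  1I : I → ℝ
  1I x = 1r + - val x

  private
    lo : ∀ x → 0r ≤ x → x ≤ 1r → 0r ≤ 1r + - x
    lo x p q = subst (λ z → z ≤ 1r + - x) (-‿inverseʳ x) (+-monoˡ-≤ (- x) q)

    up : ∀ x → 0r ≤ x → x ≤ 1r → 1r + - x ≤ 1r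
    up x p q = subst₂' (+-monoˡ-≤ 1r h)
      where
      h : - x ≤ 0r
      h = subst₂'' (+-monoˡ-≤ (- x) p)
        where
        subst₂'' : 0r + - x ≤ x + - x → - x ≤ 0r
        subst₂'' r = subst (λ z → z ≤ 0r) (+-identityˡ (- x))
                       (subst (λ z → 0r + - x ≤ z) (-‿inverseʳ x) r)
      subst₂' : - x + 1r ≤ 0r + 1r → 1r + - x ≤ 1r
      subst₂' r = subst (λ z → z ≤ 1r) (+-comm (- x) 1r)
                    (subst (λ z → - x + 1r ≤ z) (+-identityˡ 1r) r)

  compl : I → I
  compl (x , p , q) = 1r + - x , lo x p q , up x p q

  maxI : I → I → I
  maxI x y with total (val x) (val y)
  ... | inj₁ _ = y
  ... | inj₂ _ = x

  minI : I → I → I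
  minI x y with total (val x) (val y)
  ... | inj₁ _ = x
  ... | inj₂ _ = y

  _≈I_ : I → I → Set
  x ≈I y = val x ≡ val y

  Fuzzy : Scheme → Set
  Fuzzy S = τ S → I

  Neut : Scheme → Set
  Neut S = τ S → I × I

  _⁺ : I × I → I
  _⁺ = proj₁
  _⁻ : I × I → I
  _⁻ = proj₂

  Consistent : ∀ {S} → Neut S → Set
  Consistent R = ∀ t → val ((R t) ⁺) + val ((R t) ⁻) ≤ 1r

  FSet : Scheme → Set₁
  FSet S = Fuzzy S → Set

  _≐_ : ∀ {S} → Fuzzy S → Fuzzy S → Set
  Q ≐ Q' = ∀ t → Q t ≈I Q' t

  _≅_ : ∀ {S} → FSet S → FSet S → Set
  A ≅ B = ∀ Q → A Q ⇔ B Q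

  reps : ∀ S → Neut S → FSet S
  reps S R Q = ∀ t → (val ((R t) ⁺) ≤ val (Q t)) × (val (Q t) ≤ 1I ((R t) ⁻))

  𝒮₁ : ∀ {S₁ S₂} → (Fuzzy S₁ → Fuzzy S₂) → FSet S₁ → FSet S₂
  𝒮₁ {S₁} {S₂} Θ M Q = ∃ λ R → M R × (_≐_ {S₂} (Θ R) Q)

  𝒮₂ : ∀ {S₁ S₂ S₃} → (Fuzzy S₁ → Fuzzy S₂ → Fuzzy S₃) →
       FSet S₁ → FSet S₂ → FSet S₃
  𝒮₂ {S₁} {S₂} {S₃} Θ M₁ M₂ Q =
    ∃ λ R₁ → ∃ λ R₂ → M₁ R₁ × M₂ R₂ × (_≐_ {S₃} (Θ R₁ R₂) Q)

  -- strong generalization (the paper's definition, instantiated to n = 1, 2)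
  StrongGen₁ : ∀ S₁ S₂ → (Neut S₁ → Neut S₂) → (Fuzzy S₁ → Fuzzy S₂) → Set
  StrongGen₁ S₁ S₂ Ψ Θ =
    ∀ (R : Neut S₁) → Consistent {S₁} R →
      Consistent {S₂} (Ψ R) ×
      (_≅_ {S₂} (reps S₂ (Ψ R)) (𝒮₁ {S₁} {S₂} Θ (reps S₁ R)))

  StrongGen₂ : ∀ S₁ S₂ S₃ → (Neut S₁ → Neut S₂ → Neut S₃) →
               (Fuzzy S₁ → Fuzzy S₂ → Fuzzy S₃) → Set
  StrongGen₂ S₁ S₂ S₃ Ψ Θ =
    ∀ (R₁ : Neut S₁) (R₂ : Neut S₂) → Consistent {S₁} R₁ → Consistent {S₂} R₂ →
      Consistent {S₃} (Ψ R₁ R₂) ×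
      (_≅_ {S₃} (reps S₃ (Ψ R₁ R₂))
                (𝒮₂ {S₁} {S₂} {S₃} Θ (reps S₁ R₁) (reps S₂ R₂)))

  _∪_ : ∀ {S} → Fuzzy S → Fuzzy S → Fuzzy S
  (R ∪ R') t = maxI (R t) (R' t)

  ─_ : ∀ {S} → Fuzzy S → Fuzzy S
  (─ R) t = compl (R t)

  _∪̂_ : ∀ {S} → Neut S → Neut S → Neut S
  (R ∪̂ R') t = maxI ((R t) ⁺) ((R' t) ⁺) , minI ((R t) ⁻) ((R' t) ⁻)

  ─̂_ : ∀ {S} → Neut S → Neut S
  (─̂ R) t = (R t) ⁻ , (R t) ⁺

-- A consistent neutrosophic relation R represents exactly the fuzzy
-- relations lying pointwise in the nonempty interval [R⁺, 1 - R⁻].  Both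
-- operators act tuple by tuple, so it suffices to compute images of
-- intervals: x ↦ 1 - x maps [a, 1 - b] onto [b, 1 - a], and max maps
-- [a, 1 - b] × [a′, 1 - b′] onto [max a a′, 1 - min b b′].
module Submission where

open import Defs
open import Algebra.Bundles using (AbelianGroup)
open import Algebra.Structures using (IsCommutativeRing)
open import Data.Product using (_×_; _,_; ∃; ∃₂; proj₁; proj₂; swap)
open import Data.Sum using (inj₁; inj₂)
open import Function.Bundles using (_⇔_; mk⇔; Equivalence)
open import Relation.Binary.PropositionalEquality using (_≡_; refl; sym; cong; module ≡-Reasoning)
open import Relation.Binary.Structures using (IsTotalOrder)

module _ (ℛ : Reals) where
  open WithReals ℛ
  open IsCommutativeRing isCommutativeRing using (+-isAbelianGroup; +-comm; +-assoc)
  open IsTotalOrder isTotalOrder using (total; trans; antisym; ≤-respˡ-≈; ≤-respʳ-≈)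
    renaming (refl to ≤-refl)

  +-abelianGroup : AbelianGroup _ _
  +-abelianGroup = record { isAbelianGroup = +-isAbelianGroup }

  open import Algebra.Properties.AbelianGroup +-abelianGroup
    using (//-rightDividesˡ; //-rightDividesʳ; ⁻¹-anti-homo‿-; xyx⁻¹≈y)

  +-monoʳ-≤ : ∀ {x y} z → x ≤ y → z + x ≤ z + y
  +-monoʳ-≤ {x} {y} z x≤y = ≤-respˡ-≈ (+-comm x z) (≤-respʳ-≈ (+-comm y z) (+-monoˡ-≤ z x≤y))

  x+y≤z⇒x≤z-y : ∀ {x y z} → x + y ≤ z → x ≤ z + - y
  x+y≤z⇒x≤z-y {x} {y} p = ≤-respˡ-≈ (//-rightDividesʳ y x) (+-monoˡ-≤ (- y) p)

  x≤z-y⇒x+y≤z : ∀ {x y z} → x ≤ z + - y → x + y ≤ z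
  x≤z-y⇒x+y≤z {x} {y} {z} p = ≤-respʳ-≈ (//-rightDividesˡ y z) (+-monoˡ-≤ y p)

  x≤z-y⇒y≤z-x : ∀ {x y z} → x ≤ z + - y → y ≤ z + - x
  x≤z-y⇒y≤z-x {x} {y} p = x+y≤z⇒x≤z-y (≤-respˡ-≈ (+-comm x y) (x≤z-y⇒x+y≤z p))

  z-‿antitone : ∀ {x y} z → x ≤ y → z + - y ≤ z + - x
  z-‿antitone {y = y} z x≤y =
    x+y≤z⇒x≤z-y (≤-respʳ-≈ (//-rightDividesˡ y z) (+-monoʳ-≤ (z + - y) x≤y))

  z-[z-x]≡x : ∀ z x → z + - (z + - x) ≡ x
  z-[z-x]≡x z x = begin
    z + - (z + - x)  ≡⟨ cong (z +_) (⁻¹-anti-homo‿- z x) ⟩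
    z + (x + - z)    ≡⟨ sym (+-assoc z x (- z)) ⟩
    z + x + - z      ≡⟨ xyx⁻¹≈y z x ⟩
    x                ∎
    where open ≡-Reasoning

  max-≤-left : ∀ x y → val x ≤ val (maxI x y)
  max-≤-left x y with total (val x) (val y)
  ... | inj₁ x≤y = x≤y
  ... | inj₂ _   = ≤-refl

  max-≤-right : ∀ x y → val y ≤ val (maxI x y)
  max-≤-right x y with total (val x) (val y)
  ... | inj₁ _   = ≤-refl
  ... | inj₂ y≤x = y≤x

  max-least : ∀ x y {z} → val x ≤ z → val y ≤ z → val (maxI x y) ≤ z
  max-least x y x≤z y≤z with total (val x) (val y)
  ... | inj₁ _ = y≤z
  ... | inj₂ _ = x≤z

  max-left : ∀ x y → val y ≤ val x → maxI x y ≈I x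
  max-left x y y≤x with total (val x) (val y)
  ... | inj₁ x≤y = antisym y≤x x≤y
  ... | inj₂ _   = refl

  max-right : ∀ x y → val x ≤ val y → maxI x y ≈I y
  max-right x y x≤y with total (val x) (val y)
  ... | inj₁ _   = refl
  ... | inj₂ y≤x = antisym x≤y y≤x

  min-≤-left : ∀ x y → val (minI x y) ≤ val x
  min-≤-left x y with total (val x) (val y)
  ... | inj₁ _   = ≤-refl
  ... | inj₂ y≤x = y≤x

  min-≤-right : ∀ x y → val (minI x y) ≤ val y
  min-≤-right x y with total (val x) (val y)
  ... | inj₁ x≤y = x≤y
  ... | inj₂ _   = ≤-refl

  -- A neutrosophic value p = ⟨p⁺, p⁻⟩ stands for the interval [p⁺, 1 - p⁻]
  -- of truth degrees, so reps S R Q is definitionally ∀ t → Q t ∈⟦ R t ⟧.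
  _∈⟦_⟧ : I → I × I → Set
  q ∈⟦ p ⟧ = (val (p ⁺) ≤ val q) × (val q ≤ 1I (p ⁻))

  ConsistentValue : I × I → Set
  ConsistentValue p = val (p ⁺) + val (p ⁻) ≤ 1r

  _⊔̂_ : I × I → I × I → I × I
  p ⊔̂ p′ = maxI (p ⁺) (p′ ⁺) , minI (p ⁻) (p′ ⁻)

  ∈⟦⟧-resp-≈I : ∀ {p q q′} → q ≈I q′ → q ∈⟦ p ⟧ → q′ ∈⟦ p ⟧
  ∈⟦⟧-resp-≈I q≈q′ (lo , hi) = ≤-respʳ-≈ q≈q′ lo , ≤-respˡ-≈ q≈q′ hi

  lower∈⟦⟧ : ∀ {p} → ConsistentValue p → p ⁺ ∈⟦ p ⟧
  lower∈⟦⟧ c = ≤-refl , x+y≤z⇒x≤z-y c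

  swap-consistent : ∀ {p} → ConsistentValue p → ConsistentValue (swap p)
  swap-consistent {p} = ≤-respˡ-≈ (+-comm (val (p ⁺)) (val (p ⁻)))

  ⊔̂-consistent : ∀ {p p′} → ConsistentValue p → ConsistentValue p′ → ConsistentValue (p ⊔̂ p′)
  ⊔̂-consistent {p} {p′} c c′ = x≤z-y⇒x+y≤z (max-least (p ⁺) (p′ ⁺)
    (trans (x+y≤z⇒x≤z-y c) (z-‿antitone 1r (min-≤-left (p ⁻) (p′ ⁻))))
    (trans (x+y≤z⇒x≤z-y c′) (z-‿antitone 1r (min-≤-right (p ⁻) (p′ ⁻)))))

  max∈⟦⊔̂⟧ : ∀ {p p′ q q′} → q ∈⟦ p ⟧ → q′ ∈⟦ p′ ⟧ → maxI q q′ ∈⟦ p ⊔̂ p′ ⟧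
  max∈⟦⊔̂⟧ {p} {p′} {q} {q′} (lo , hi) (lo′ , hi′) =
    max-least (p ⁺) (p′ ⁺) (trans lo (max-≤-left q q′)) (trans lo′ (max-≤-right q q′)) ,
    max-least q q′ (trans hi (z-‿antitone 1r (min-≤-left (p ⁻) (p′ ⁻))))
                   (trans hi′ (z-‿antitone 1r (min-≤-right (p ⁻) (p′ ⁻))))

  -- The side whose falsity bound realises the minimum takes q itself; the
  -- other side takes its lower endpoint, which lies below q.
  ∈⟦⊔̂⟧⇒max-split : ∀ {p p′ q} → ConsistentValue p → ConsistentValue p′ → q ∈⟦ p ⊔̂ p′ ⟧ →
                   ∃₂ λ r r′ → r ∈⟦ p ⟧ × r′ ∈⟦ p′ ⟧ × maxI r r′ ≈I q
  ∈⟦⊔̂⟧⇒max-split {p} {p′} {q} c c′ (lo , hi) with total (val (p ⁻)) (val (p′ ⁻))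
  ... | inj₁ _ = q , p′ ⁺ , (trans (max-≤-left (p ⁺) (p′ ⁺)) lo , hi) , lower∈⟦⟧ {p′} c′ ,
                 max-left q (p′ ⁺) (trans (max-≤-right (p ⁺) (p′ ⁺)) lo)
  ... | inj₂ _ = p ⁺ , q , lower∈⟦⟧ {p} c , (trans (max-≤-right (p ⁺) (p′ ⁺)) lo , hi) ,
                 max-right (p ⁺) q (trans (max-≤-left (p ⁺) (p′ ⁺)) lo)

  ∈⟦⊔̂⟧⇔max-split : ∀ {p p′ q} → ConsistentValue p → ConsistentValue p′ →
                   q ∈⟦ p ⊔̂ p′ ⟧ ⇔ ∃₂ λ r r′ → r ∈⟦ p ⟧ × r′ ∈⟦ p′ ⟧ × maxI r r′ ≈I q
  ∈⟦⊔̂⟧⇔max-split {p} {p′} {q} c c′ = mk⇔ (∈⟦⊔̂⟧⇒max-split {p} {p′} {q} c c′)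
    λ (r , r′ , r∈ , r′∈ , max≈q) →
      ∈⟦⟧-resp-≈I {p ⊔̂ p′} {maxI r r′} {q} max≈q (max∈⟦⊔̂⟧ {p} {p′} r∈ r′∈)

  ∈⟦swap⟧⇔compl : ∀ {p q} → q ∈⟦ swap p ⟧ ⇔ ∃ λ r → r ∈⟦ p ⟧ × compl r ≈I q
  ∈⟦swap⟧⇔compl {p} {q} = mk⇔
    (λ (lo , hi) → compl q , (x≤z-y⇒y≤z-x hi , z-‿antitone 1r lo) , z-[z-x]≡x 1r (val q))
    (λ (r , (lo , hi) , compl≈q) →
      ∈⟦⟧-resp-≈I {swap p} {compl r} {q} compl≈q (x≤z-y⇒y≤z-x hi , z-‿antitone 1r lo))

  module _ {S : Scheme} where

    Pointwise : (τ S → I → Set) → FSet S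
    Pointwise A Q = ∀ t → A t (Q t)

    𝒮₁-pointwise : (θ : I → I) (A B : τ S → I → Set) →
                   (∀ t q → B t q ⇔ ∃ λ r → A t r × θ r ≈I q) →
                   _≅_ {S} (Pointwise B) (𝒮₁ {S} {S} (λ R t → θ (R t)) (Pointwise A))
    𝒮₁-pointwise θ A B B⇔ Q = mk⇔ split
      (λ (R , R∈A , θR≐Q) t → from (B⇔ t (Q t)) (R t , R∈A t , θR≐Q t))
      where
      open Equivalence
      split : Pointwise B Q → 𝒮₁ {S} {S} (λ R t → θ (R t)) (Pointwise A) Q
      split Q∈B = (λ t → proj₁ (w t)) , (λ t → proj₁ (proj₂ (w t))) , (λ t → proj₂ (proj₂ (w t)))
        where w = λ t → to (B⇔ t (Q t)) (Q∈B t)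

    𝒮₂-pointwise : (θ : I → I → I) (A A′ B : τ S → I → Set) →
                   (∀ t q → B t q ⇔ ∃₂ λ r r′ → A t r × A′ t r′ × θ r r′ ≈I q) →
                   _≅_ {S} (Pointwise B)
                           (𝒮₂ {S} {S} {S} (λ R R′ t → θ (R t) (R′ t)) (Pointwise A) (Pointwise A′))
    𝒮₂-pointwise θ A A′ B B⇔ Q = mk⇔ split
      (λ (R , R′ , R∈A , R′∈A′ , θRR′≐Q) t →
         from (B⇔ t (Q t)) (R t , R′ t , R∈A t , R′∈A′ t , θRR′≐Q t))
      where
      open Equivalence
      split : Pointwise B Q →
              𝒮₂ {S} {S} {S} (λ R R′ t → θ (R t) (R′ t)) (Pointwise A) (Pointwise A′) Q
      split Q∈B = (λ t → proj₁ (w t)) , (λ t → proj₁ (proj₂ (w t))) ,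
                  (λ t → proj₁ (proj₂ (proj₂ (w t)))) ,
                  (λ t → proj₁ (proj₂ (proj₂ (proj₂ (w t))))) ,
                  (λ t → proj₂ (proj₂ (proj₂ (proj₂ (w t)))))
        where w = λ t → to (B⇔ t (Q t)) (Q∈B t)

  ∪̂-strongGen : ∀ S → StrongGen₂ S S S (_∪̂_ {S}) (_∪_ {S})
  ∪̂-strongGen S R R′ c c′ =
    (λ t → ⊔̂-consistent {R t} {R′ t} (c t) (c′ t)) ,
    𝒮₂-pointwise {S} maxI (λ t q → q ∈⟦ R t ⟧) (λ t q → q ∈⟦ R′ t ⟧) (λ t q → q ∈⟦ R t ⊔̂ R′ t ⟧)
      (λ t q → ∈⟦⊔̂⟧⇔max-split {R t} {R′ t} {q} (c t) (c′ t))

  ─̂-strongGen : ∀ S → StrongGen₁ S S (─̂_ {S}) (─_ {S})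
  ─̂-strongGen S R c =
    (λ t → swap-consistent {R t} (c t)) ,
    𝒮₁-pointwise {S} compl (λ t q → q ∈⟦ R t ⟧) (λ t q → q ∈⟦ swap (R t) ⟧)
      (λ t q → ∈⟦swap⟧⇔compl {R t} {q})

mainTheorem10 : (ℛ : Reals) → (S : Scheme) →
    let open WithReals ℛ in
    StrongGen₂ S S S (_∪̂_ {S}) (_∪_ {S}) × StrongGen₁ S S (─̂_ {S}) (─_ {S})
mainTheorem10 ℛ S = ∪̂-strongGen ℛ S , ─̂-strongGen ℛ S
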